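{- Let $(\mathcal{U},\mathcal{F})$ be a Set Cover instance, let $G = f(\mathcal{U},\mathcal{F})$, and let $x \in \mathcal{U}$. If $L$ is an ordering of the vertices of $G_x$ with $\mathrm{wcol}_c(G_x, L) \le t$, then for every $S \in \mathcal{F}$ with $x \in S$ we have $L(u) < L(v_S^1)$ for all $u \in D_x \cup \{p_{S,x}^1, \dots, p_{S,x}^\ell\}$.
   Context: Graphs are finite and simple. An ordering of a graph $H$ is a bijection $L: V(H) \to \{1,\dots,|V(H)|\}$. For an integer $c$, an ordering $L$ and a vertex $v$, $\mathrm{WReach}_c[H,L,v]$ is the set of vertices $u \neq v$ such that there is a path in $H$ from $v$ to $u$ with at most $c$ edges all of whose vertices $w$ satisfy $L(w) \le L(u)$; $\mathrm{wcol}_c(H,L) = \max_v |\mathrm{WReach}_c[H,L,v]|$, $\mathrm{wcol}_c(H) = \min_L \mathrm{wcol}_c(H,L)$. Construction: a Set Cover instance $(\mathcal{U},\mathcal{F})$ consists of a finite universe $\mathcal{U}$ and a family $\mathcal{F}$ of subsets of $\mathcal{U}$, each element lying in at least one set; $f_x$ is the number of sets containing $x$ and $f_{\max} = \max_x f_x$. Fix an integer $c \ge 3$, let $\ell = \lfloor c/2 \rfloor$, and let $t$ be the smallest integer with $t \ge 4 f_{\max}$ and $t \ge \ell + 3 f_{\max} - 2$. For $S \in \mathcal{F}$, the set gadget $W_S$ consists of disjoint cliques $D_S^1$ on $t$ vertices and $D_S^2$ on $t+1$ vertices, with distinguished vertices $v_S^1 \in D_S^1$, $v_S^2 \in D_S^2$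 joined by an edge. For $x \in \mathcal{U}$, the element gadget $G_x$ consists of a clique $D_x$ on $t - 3f_x + 2$ vertices and, for each $S \in \mathcal{F}$ with $x \in S$: the set gadget $W_S$, a clique $D_{S,x}$ on $f_x$ vertices, and a path $p_{S,x}^1, \dots, p_{S,x}^\ell$ of $\ell$ new vertices, where $p_{S,x}^1$ is adjacent to every vertex of $D_x$ and of $D_{S,x}$, and $p_{S,x}^\ell$ is adjacent to $v_S^1$. The graph $G = f(\mathcal{U},\mathcal{F})$ is the union of all $G_x$, $x \in \mathcal{U}$, where for each $S$ there is a single copy of $W_S$ shared by all $G_x$ with $x \in S$ (all other parts are disjoint); each $G_x$ is an induced subgraph of $G$. -}

module Defs where

open import Data.Nat using (ℕ; zero; suc; _+_; _*_; _∸_; _⊔_; _≤_; _<_; ⌊_/2⌋)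
open import Data.Fin using (Fin; toℕ) renaming (_≤_ to _≤ᶠ_)
open import Data.Bool using (Bool; true; false; T)
open import Data.Vec using (Vec; lookup)
open import Data.List using (List; []; _∷_; _++_; length; filter; map; foldr; allFin)
open import Data.List.Relation.Unary.All using (All)
open import Data.List.Relation.Unary.Linked using (Linked)
open import Data.List.Relation.Unary.Unique.Propositional using (Unique)
open import Data.Fin.Subset using (Subset)
open import Data.Product using (Σ; ∃; _×_)
open import Data.Sum using (_⊎_)
open import Data.Empty using (⊥)
open import Data.Unit using (⊤)
open import Relation.Binary.PropositionalEquality using (_≡_; _≢_)
open import Data.Bool.Properties using (T?)

-- The path is  v ∷ mid ++ [u],
-- which has  length mid + 1  edges.
WReach : {V : Set} (E : V → V → Set) {N : ℕ} (L : V → Fin N)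
         (c : ℕ) (v u : V) → Set
WReach {V} E L c v u =
  u ≢ v ×
  ∃ λ (mid : List V) →
    let ws = v ∷ (mid ++ (u ∷ [])) in
    Linked E ws × Unique ws × suc (length mid) ≤ c ×
    All (λ w → L w ≤ᶠ L u) ws

WcolAtMost : {V : Set} (E : V → V → Set) {N : ℕ} (L : V → Fin N)
             (c k : ℕ) → Set
WcolAtMost {V} E L c k =
  (v : V) (us : List V) → Unique us → All (WReach E L c v) us →
  length us ≤ k

_∈ₛ_ : {n : ℕ} → Fin n → Subset n → Set
x ∈ₛ S = T (lookup S x)

IsSetCoverInstance : (n m : ℕ) → (Fin m → Subset n) → Set
IsSetCoverInstance n m F = (x : Fin n) → ∃ λ (S : Fin m) → x ∈ₛ F S

freq : {n m : ℕ} → (Fin m → Subset n) → Fin n → ℕ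
freq {n} {m} F x = length (filter (λ S → T? (lookup (F S) x)) (allFin m))

fmax : {n m : ℕ} → (Fin m → Subset n) → ℕ
fmax {n} F = foldr _⊔_ 0 (map (freq F) (allFin n))

-- The element gadget G_x of f(U,F), for fixed c, built as its own graph
-- (it is an induced subgraph of G).

module Gadget (c n m : ℕ) (F : Fin m → Subset n) (x : Fin n) where

  ℓ : ℕ
  ℓ = ⌊ c /2⌋

  fx : ℕ
  fx = freq F x

  t : ℕ
  t = (4 * fmax F) ⊔ (ℓ + 3 * fmax F ∸ 2)

  data V : Set where
    dx   : Fin (t ∸ 3 * fx + 2) → V
    v1   : (S : Fin m) → x ∈ₛ F S → V
    d1   : (S : Fin m) → x ∈ₛ F S → Fin (t ∸ 1) → V
    v2   : (S : Fin m) → x ∈ₛ F S → V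
    d2   : (S : Fin m) → x ∈ₛ F S → Fin t → V
    dsx  : (S : Fin m) → x ∈ₛ F S → Fin fx → V
    -- the path p_{S,x}^1 … p_{S,x}^ℓ ; index i : Fin ℓ is p^{i+1}
    p    : (S : Fin m) → x ∈ₛ F S → Fin ℓ → V

  E : V → V → Set
  E (dx i)      (dx j)       = i ≢ j
  E (v1 S _)    (d1 S' _ j)  = S ≡ S'
  E (d1 S _ i)  (v1 S' _)    = S ≡ S'
  E (d1 S _ i)  (d1 S' _ j)  = S ≡ S' × i ≢ j
  E (v2 S _)    (d2 S' _ j)  = S ≡ S'
  E (d2 S _ i)  (v2 S' _)    = S ≡ S'
  E (d2 S _ i)  (d2 S' _ j)  = S ≡ S' × i ≢ j
  E (v1 S _)    (v2 S' _)    = S ≡ S'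
  E (v2 S _)    (v1 S' _)    = S ≡ S'
  E (dsx S _ i) (dsx S' _ j) = S ≡ S' × i ≢ j
  E (p S _ i)   (p S' _ j)   = S ≡ S' × (suc (toℕ i) ≡ toℕ j ⊎ suc (toℕ j) ≡ toℕ i)
  E (p S _ i)   (dx j)       = toℕ i ≡ 0
  E (dx j)      (p S _ i)    = toℕ i ≡ 0
  E (p S _ i)   (dsx S' _ j) = S ≡ S' × toℕ i ≡ 0
  E (dsx S' _ j) (p S _ i)   = S ≡ S' × toℕ i ≡ 0
  E (p S _ i)   (v1 S' _)    = S ≡ S' × suc (toℕ i) ≡ ℓ
  E (v1 S' _)   (p S _ i)    = S ≡ S' × suc (toℕ i) ≡ ℓ
  E _           _            = ⊥

-- The whole argument rests on one counting principle (`crowded-clique`): the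
-- L-minimal vertex y of a clique K weakly reaches the other |K| − 1 vertices
-- of K in one step, so it can weakly reach at most t − |K| + 1 further vertices.
--
--  1. K = D_S^2 (t + 1 vertices): y could reach nothing else, so v_S^1 must be
--     unreachable from y, which forces L(v_S^1) < L(v_S^2).
--  2. K = D_S^1 (t vertices): y may reach only one vertex outside D_S^1, and it
--     does reach v_S^2 (by step 1).  Hence no vertex u of D_x or of the path
--     can be reached from v_S^1 by a path with at most c − 1 edges through
--     vertices not larger than u (`no-low-route`).
--  3. The path v_S^1, p^ℓ, …, p^1, D_x has ℓ + 1 ≤ c − 1 edges.  By downward
--     induction along it, a vertex u of it with L(u) > L(v_S^1) would produce
--     exactly such a route; so every p^i and every vertex of D_x is below v_S^1.
module Submission where

open import Defs
open import Data.Nat using (ℕ; _≤_; _+_; _*_; _∸_)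
open import Data.Fin using (Fin; _<_)
open import Data.Fin.Subset using (Subset)
open import Data.Product using (_×_)
open import Function.Definitions using (Bijective)
open import Relation.Binary.PropositionalEquality using (_≡_)

import Data.Nat as ℕ
open import Data.Nat using (zero; suc; z≤n; s≤s; ⌊_/2⌋)
import Data.Nat.Properties as NP
open import Data.Nat.DivMod using (_mod_; m≤n⇒m%n≡m)
open import Data.Fin using (toℕ) renaming (_≤_ to _≤ᶠ_)
import Data.Fin.Properties as FP
open import Data.List using (List; []; _∷_; _++_; length; filter; map; allFin)
open import Data.List.Extrema.Nat using (argmin; argmin-all; f[argmin]≤f[⊤]; f[argmin]≤f[xs])
open import Data.List.Properties using (filter-all; filter-accept; filter-reject; length-++; ++-assoc; length-map; length-tabulate)
open import Data.List.Relation.Unary.All as All using (All; []; _∷_)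
import Data.List.Relation.Unary.All.Properties as AllP
open import Data.List.Relation.Unary.Any using (here; there)
open import Data.List.Relation.Unary.Linked as Linked using (Linked; [-]; _∷_)
open import Data.List.Relation.Unary.Linked.Properties using (Linked⇒AllPairs)
open import Data.List.Relation.Unary.AllPairs as AllPairs using ([]; _∷_)
open import Data.List.Relation.Unary.Unique.Propositional using (Unique)
import Data.List.Relation.Unary.Unique.Propositional.Properties as UniqueP
open import Data.List.Membership.Propositional using (_∈_; _∉_)
open import Data.List.Membership.Propositional.Properties using (∈-filter⁻; ∈-map⁻; ∈-++⁺ʳ)
open import Data.Product using (∃; _,_; proj₁; proj₂)
open import Data.Sum using (_⊎_; inj₁; inj₂)
open import Data.Empty using (⊥; ⊥-elim)
open import Relation.Nullary using (Dec; ¬_)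
open import Relation.Nullary.Decidable using (¬?; map′)
open import Relation.Binary.PropositionalEquality using (refl; sym; trans; cong; subst; _≢_)

-- |D_S^1| = t, so a vertex reaching two vertices besides D_S^1 overflows.
2+pred-overflow : ∀ t → ¬ (2 + (t ∸ 1) ≤ t)
2+pred-overflow zero    ()
2+pred-overflow (suc t) (s≤s t+1≤t) = NP.<-irrefl refl t+1≤t

module WeakReachability {V : Set} (E : V → V → Set) {N : ℕ} (L : V → Fin N)
                        (L-injective : ∀ {a b} → L a ≡ L b → a ≡ b) where

  label : V → ℕ
  label v = toℕ (L v)

  _≟_ : (a b : V) → Dec (a ≡ b)
  a ≟ b = map′ L-injective (cong L) (L a FP.≟ L b)

  _without_ : List V → V → List V
  ws without y = filter (λ w → ¬? (w ≟ y)) ws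

  length-without : ∀ {y} ws → Unique ws → y ∈ ws → suc (length (ws without y)) ≡ length ws
  length-without {y} (a ∷ as) (a∉as ∷ _) (here refl)
    rewrite filter-reject (λ w → ¬? (w ≟ y)) {x = a} {xs = as} (λ a≢a → a≢a refl)
          | filter-all (λ w → ¬? (w ≟ y)) {xs = as} (All.map (λ a≢w w≡a → a≢w (sym w≡a)) a∉as)
          = refl
  length-without {y} (a ∷ as) (a∉as ∷ as-unique) (there y∈as)
    rewrite filter-accept (λ w → ¬? (w ≟ y)) {x = a} {xs = as} (All.lookup a∉as y∈as)
          = cong suc (length-without as as-unique y∈as)

  Descent : (V → ℕ) → V → V → Set
  Descent rk a b = E a b × rk b ℕ.< rk a

  descent-unique : (rk : V → ℕ) {ws : List V} → Linked (Descent rk) ws → Unique ws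
  descent-unique rk walk =
    AllPairs.map (λ rk-drop a≡b → NP.<-irrefl (cong rk (sym a≡b)) rk-drop)
      (Linked⇒AllPairs (λ b<a c<b → NP.<-trans c<b b<a) (Linked.map proj₂ walk))

  descent-reach : (rk : V → ℕ) {c : ℕ} {a b : V} (mid : List V) →
    Linked (Descent rk) (a ∷ mid ++ b ∷ []) → suc (length mid) ≤ c →
    All (λ w → L w ≤ᶠ L b) (a ∷ mid ++ b ∷ []) → WReach E L c a b
  descent-reach rk {a = a} {b} mid walk short low =
    b≢a , mid , Linked.map proj₁ walk , walk-unique , short , low
    where
    walk-unique : Unique (a ∷ mid ++ b ∷ [])
    walk-unique = descent-unique rk walk

    b≢a : b ≢ a
    b≢a b≡a = All.lookup (AllPairs.head walk-unique) (∈-++⁺ʳ mid (here refl)) (sym b≡a)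

  Clique : List V → Set
  Clique ws = ∀ {a b} → a ∈ ws → b ∈ ws → a ≢ b → E a b

  cliqueList : V → {k : ℕ} → (Fin k → V) → List V
  cliqueList a {k} f = a ∷ map f (allFin k)

  ∈-cliqueList : ∀ {a k} {f : Fin k → V} {w} → w ∈ cliqueList a f → w ≡ a ⊎ ∃ λ i → w ≡ f i
  ∈-cliqueList (here w≡a) = inj₁ w≡a
  ∈-cliqueList (there w∈) with ∈-map⁻ _ w∈
  ... | i , _ , w≡fi = inj₂ (i , w≡fi)

  length-map-allFin : ∀ {k} (f : Fin k → V) → length (map f (allFin k)) ≡ k
  length-map-allFin {k} f = trans (length-map f (allFin k)) (length-tabulate (λ i → i))

  cliqueList-unique : ∀ {a k} {f : Fin k → V} → (∀ i → f i ≢ a) →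
    (∀ {i j} → f i ≡ f j → i ≡ j) → Unique (cliqueList a f)
  cliqueList-unique {k = k} {f} fi≢a f-injective =
    All.tabulate a≢member ∷ UniqueP.map⁺ f-injective (UniqueP.allFin⁺ k)
    where
    a≢member : ∀ {w} → w ∈ map f (allFin k) → _ ≢ w
    a≢member w∈ a≡w with ∈-map⁻ _ w∈
    ... | i , _ , w≡fi = fi≢a i (trans (sym w≡fi) (sym a≡w))

  cliqueList-clique : ∀ {a k} {f : Fin k → V} → (∀ i → E a (f i)) → (∀ i → E (f i) a) →
    (∀ {i j} → i ≢ j → E (f i) (f j)) → Clique (cliqueList a f)
  cliqueList-clique {f = f} apex-out apex-in sides a∈ b∈ a≢b
    with ∈-cliqueList a∈ | ∈-cliqueList b∈
  ... | inj₁ refl       | inj₁ refl       = ⊥-elim (a≢b refl)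
  ... | inj₁ refl       | inj₂ (j , refl) = apex-out j
  ... | inj₂ (i , refl) | inj₁ refl       = apex-in i
  ... | inj₂ (i , refl) | inj₂ (j , refl) = sides (λ i≡j → a≢b (cong f i≡j))

  clique-min-reach : ∀ {c ws y} → 1 ≤ c → Clique ws → y ∈ ws →
    All (λ w → L y ≤ᶠ L w) ws → All (WReach E L c y) (ws without y)
  clique-min-reach {y = y} one≤c clique y∈ y-min = All.tabulate λ w∈ →
    let (w∈ws , w≢y) = ∈-filter⁻ (λ w → ¬? (w ≟ y)) w∈
        y≢w = λ y≡w → w≢y (sym y≡w) in
    w≢y , [] , (clique y∈ w∈ws y≢w ∷ [-]) , ((y≢w ∷ []) ∷ [] ∷ []) , one≤c ,
    (All.lookup y-min w∈ws ∷ NP.≤-refl ∷ [])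

  crowded-clique : ∀ {c k} → WcolAtMost E L c k → 1 ≤ c →
    (a : V) (as : List V) → Unique (a ∷ as) → Clique (a ∷ as) →
    (xs : List V) → Unique xs → All (_∉ a ∷ as) xs →
    (∀ {y} → y ∈ a ∷ as → All (λ w → L y ≤ᶠ L w) (a ∷ as) → All (WReach E L c y) xs) →
    length xs + length as ≤ k
  crowded-clique wcol one≤c a as ws-unique clique xs xs-unique xs-outside reach =
    subst (_≤ _) reached-size (wcol y (xs ++ rest) reached-unique reached)
    where
    y : V
    y = argmin label a as

    y∈ : y ∈ a ∷ as
    y∈ = argmin-all label {P = _∈ a ∷ as} (here refl) (All.tabulate there)

    y-min : All (λ w → L y ≤ᶠ L w) (a ∷ as)
    y-min = f[argmin]≤f[⊤] {f = label} a as ∷ f[argmin]≤f[xs] {f = label} a as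

    rest : List V
    rest = (a ∷ as) without y

    reached-unique : Unique (xs ++ rest)
    reached-unique = UniqueP.++⁺ xs-unique (UniqueP.filter⁺ (λ w → ¬? (w ≟ y)) ws-unique)
      λ (w∈xs , w∈rest) → All.lookup xs-outside w∈xs (proj₁ (∈-filter⁻ (λ w → ¬? (w ≟ y)) w∈rest))

    reached : All (WReach E L _ y) (xs ++ rest)
    reached = AllP.++⁺ (reach y∈ y-min) (clique-min-reach one≤c clique y∈ y-min)

    reached-size : length (xs ++ rest) ≡ length xs + length as
    reached-size = trans (length-++ xs) (cong (length xs +_)
      (NP.suc-injective (length-without (a ∷ as) ws-unique y∈)))

-- The gadget G_x for c = 3 + c', so that ℓ = 1 + ℓ'.
module ElementGadget (c' n m : ℕ) (F : Fin m → Subset n) (x : Fin n) where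
  open Gadget (3 + c') n m F x

  ℓ' : ℕ
  ℓ' = ⌊ suc c' /2⌋

  -- The vertices of D_x and of the paths p_{S',x}: the vertices that must end
  -- up below v_S^1.
  data Low : V → Set where
    dx-low : ∀ i → Low (dx i)
    p-low  : ∀ S h i → Low (p S h i)

  module Order {N : ℕ} (L : V → Fin N) (L-injective : ∀ {a b} → L a ≡ L b → a ≡ b)
               (wcol : WcolAtMost E L (3 + c') t) (S : Fin m) (h : x ∈ₛ F S) where
    open WeakReachability E L L-injective

    D¹-rest : List V
    D¹-rest = map (d1 S h) (allFin (t ∸ 1))

    D²-rest : List V
    D²-rest = map (d2 S h) (allFin t)

    D¹ : List V
    D¹ = cliqueList (v1 S h) (d1 S h)

    D² : List V
    D² = cliqueList (v2 S h) (d2 S h)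

    D¹-unique : Unique D¹
    D¹-unique = cliqueList-unique (λ _ ()) λ { refl → refl }

    D²-unique : Unique D²
    D²-unique = cliqueList-unique (λ _ ()) λ { refl → refl }

    D¹-clique : Clique D¹
    D¹-clique = cliqueList-clique (λ _ → refl) (λ _ → refl) (λ i≢j → refl , i≢j)

    D²-clique : Clique D²
    D²-clique = cliqueList-clique (λ _ → refl) (λ _ → refl) (λ i≢j → refl , i≢j)

    -- Step 1.  Ranks making v_S^2 → v_S^1 and D_S^2 → v_S^2 descents.
    rank² : V → ℕ
    rank² (v2 _ _)   = 1
    rank² (d2 _ _ _) = 2
    rank² _          = 0

    v1∉D² : v1 S h ∉ D²
    v1∉D² v1∈ with ∈-cliqueList v1∈
    ... | inj₁ ()
    ... | inj₂ (_ , ())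

    -- If v_S^2 were below v_S^1, the minimum of D_S^2 would also reach v_S^1.
    v1<v2 : L (v1 S h) < L (v2 S h)
    v1<v2 = NP.≰⇒> overflow
      where
      overflow : ¬ (L (v2 S h) ≤ᶠ L (v1 S h))
      overflow v2≤v1 = NP.<-irrefl refl
        (subst (_≤ t) (cong suc (length-map-allFin (d2 S h)))
          (crowded-clique wcol (s≤s z≤n) (v2 S h) D²-rest D²-unique D²-clique
            (v1 S h ∷ []) ([] ∷ []) (v1∉D² ∷ []) (λ y∈ y-min → reach-v1 y∈ (All.head y-min) ∷ [])))
        where
        reach-v1 : ∀ {y} → y ∈ D² → L y ≤ᶠ L (v2 S h) → WReach E L (3 + c') y (v1 S h)
        reach-v1 y∈ y≤v2 with ∈-cliqueList y∈
        ... | inj₁ refl = descent-reach rank² [] ((refl , s≤s z≤n) ∷ [-]) (s≤s z≤n)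
              (v2≤v1 ∷ NP.≤-refl ∷ [])
        ... | inj₂ (_ , refl) = descent-reach rank² (v2 S h ∷ [])
              ((refl , NP.≤-refl) ∷ (refl , s≤s z≤n) ∷ [-]) (s≤s (s≤s z≤n))
              (NP.≤-trans y≤v2 v2≤v1 ∷ v2≤v1 ∷ NP.≤-refl ∷ [])

    -- Step 2.  Ranks making the route D_S^1 → v_S^1 → p^ℓ → … → p^1 → D_x,
    -- as well as v_S^1 → v_S^2, descents.
    rank : V → ℕ
    rank (dx _)     = 0
    rank (p _ _ i)  = suc (toℕ i)
    rank (v1 _ _)   = 2 + ℓ'
    rank (d1 _ _ _) = 3 + ℓ'
    rank _          = 0

    low∉D¹ : ∀ {u} → Low u → u ∉ D¹
    low∉D¹ low u∈ with ∈-cliqueList u∈ | low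
    ... | inj₁ refl       | ()
    ... | inj₂ (_ , refl) | ()

    v2∉D¹ : v2 S h ∉ D¹
    v2∉D¹ v2∈ with ∈-cliqueList v2∈
    ... | inj₁ ()
    ... | inj₂ (_ , ())

    low≢v2 : ∀ {u} → Low u → u ≢ v2 S h
    low≢v2 (dx-low _) ()
    low≢v2 (p-low _ _ _) ()

    -- A low vertex u is never reachable from v_S^1 by a descent of at most
    -- c − 1 edges through vertices not larger than u: otherwise the minimum of
    -- D_S^1 (t vertices) would weakly reach t − 1 + 2 vertices, v_S^2 and u
    -- included.
    no-low-route : ∀ {u} → Low u → (mid : List V) →
      Linked (Descent rank) (v1 S h ∷ mid ++ u ∷ []) → suc (suc (length mid)) ≤ 3 + c' →
      All (λ w → L w ≤ᶠ L u) (v1 S h ∷ mid ++ u ∷ []) → ⊥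
    no-low-route {u} low mid route short below = 2+pred-overflow t
      (subst (λ k → 2 + k ≤ t) (length-map-allFin (d1 S h))
        (crowded-clique wcol (s≤s z≤n) (v1 S h) D¹-rest D¹-unique D¹-clique
          (v2 S h ∷ u ∷ []) (((λ v2≡u → low≢v2 low (sym v2≡u)) ∷ []) ∷ [] ∷ [])
          (v2∉D¹ ∷ low∉D¹ low ∷ [])
          (λ y∈ y-min → reach-v2 y∈ (All.head y-min) ∷ reach-u y∈ (All.head y-min) ∷ [])))
      where
      v1≤v2 : L (v1 S h) ≤ᶠ L (v2 S h)
      v1≤v2 = NP.<⇒≤ v1<v2

      reach-v2 : ∀ {y} → y ∈ D¹ → L y ≤ᶠ L (v1 S h) → WReach E L (3 + c') y (v2 S h)
      reach-v2 y∈ y≤v1 with ∈-cliqueList y∈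
      ... | inj₁ refl = descent-reach rank [] ((refl , s≤s z≤n) ∷ [-]) (s≤s z≤n)
            (v1≤v2 ∷ NP.≤-refl ∷ [])
      ... | inj₂ (_ , refl) = descent-reach rank (v1 S h ∷ [])
            ((refl , NP.≤-refl) ∷ (refl , s≤s z≤n) ∷ [-]) (s≤s (s≤s z≤n))
            (NP.≤-trans y≤v1 v1≤v2 ∷ v1≤v2 ∷ NP.≤-refl ∷ [])

      reach-u : ∀ {y} → y ∈ D¹ → L y ≤ᶠ L (v1 S h) → WReach E L (3 + c') y u
      reach-u y∈ y≤v1 with ∈-cliqueList y∈
      ... | inj₁ refl = descent-reach rank mid route (NP.<⇒≤ short) below
      ... | inj₂ (_ , refl) = descent-reach rank (v1 S h ∷ mid) ((refl , NP.≤-refl) ∷ route)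
            short (NP.≤-trans y≤v1 (All.head below) ∷ below)

    rung : ℕ → V
    rung j = p S h (j mod suc ℓ')

    rung-index : ∀ {j} → j ≤ ℓ' → toℕ (j mod suc ℓ') ≡ j
    rung-index j≤ℓ' = trans (FP.toℕ-fromℕ< _) (m≤n⇒m%n≡m j≤ℓ')

    rung-toℕ : (i : Fin (suc ℓ')) → rung (toℕ i) ≡ p S h i
    rung-toℕ i = cong (p S h) (FP.toℕ-injective (rung-index (FP.toℕ≤pred[n] i)))

    rung-step : ∀ {k} → suc k ≤ ℓ' → Descent rank (rung (suc k)) (rung k)
    rung-step k<ℓ' rewrite rung-index (NP.<⇒≤ k<ℓ') | rung-index k<ℓ' =
      (refl , inj₂ refl) , NP.≤-refl

    top-rung : Descent rank (v1 S h) (rung ℓ')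
    top-rung rewrite rung-index (NP.≤-refl {ℓ'}) = (refl , refl) , NP.≤-refl

    bottom-rung : ∀ j → Descent rank (rung 0) (dx j)
    bottom-rung j = rung-index z≤n , s≤s z≤n

    rungs-above : ℕ → ℕ → List V
    rungs-above k zero    = []
    rungs-above k (suc d) = rung (suc d + k) ∷ rungs-above k d

    length-rungs-above : ∀ k d → length (rungs-above k d) ≡ d
    length-rungs-above k zero    = refl
    length-rungs-above k (suc d) = cong suc (length-rungs-above k d)

    rungs-above-linked : ∀ {v tail} k d → d + k ≤ ℓ' → Descent rank v (rung (d + k)) →
      Linked (Descent rank) (rung k ∷ tail) →
      Linked (Descent rank) (v ∷ rungs-above k d ++ rung k ∷ tail)
    rungs-above-linked k zero    _       v→top walk = v→top ∷ walk
    rungs-above-linked k (suc d) d+k<ℓ' v→top walk =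
      v→top ∷ rungs-above-linked k d (NP.<⇒≤ d+k<ℓ') (rung-step d+k<ℓ') walk

    rungs-above-all : ∀ {P : V → Set} k d → (∀ j → k ℕ.< j → j ≤ d + k → P (rung j)) →
      All P (rungs-above k d)
    rungs-above-all k zero    _  = []
    rungs-above-all k (suc d) Pj =
      Pj (suc d + k) (s≤s (NP.m≤n+m k d)) NP.≤-refl ∷
      rungs-above-all k d (λ j k<j j≤ → Pj j k<j (NP.m≤n⇒m≤1+n j≤))

    descent-from-v1 : ∀ {k tail} → k ≤ ℓ' → Linked (Descent rank) (rung k ∷ tail) →
      Linked (Descent rank) (v1 S h ∷ rungs-above k (ℓ' ∸ k) ++ rung k ∷ tail)
    descent-from-v1 {k} k≤ℓ' walk = rungs-above-linked k (ℓ' ∸ k) (NP.≤-reflexive top)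
      (subst (λ j → Descent rank (v1 S h) (rung j)) (sym top) top-rung) walk
      where
      top : ℓ' ∸ k + k ≡ ℓ'
      top = NP.m∸n+n≡m k≤ℓ'

    ℓ'≤c' : ℓ' ≤ c'
    ℓ'≤c' = NP.≤-pred (NP.⌊n/2⌋<n c')

    -- If all rungs above k are below v_S^1, so is rung k: otherwise the descent
    -- from v_S^1 to rung k is a forbidden low route.
    rung-below-step : ∀ k → k ≤ ℓ' → (∀ j → k ℕ.< j → j ≤ ℓ' → L (rung j) < L (v1 S h)) →
      L (rung k) < L (v1 S h)
    rung-below-step k k≤ℓ' higher-below = NP.≰⇒> low-route
      where
      route-length : 2 + length (rungs-above k (ℓ' ∸ k)) ≤ 3 + c'
      route-length rewrite length-rungs-above k (ℓ' ∸ k) =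
        s≤s (s≤s (NP.≤-trans (NP.m∸n≤m ℓ' k) (NP.m≤n⇒m≤1+n ℓ'≤c')))

      low-route : ¬ (L (v1 S h) ≤ᶠ L (rung k))
      low-route v1≤rung = no-low-route (p-low S h _) (rungs-above k (ℓ' ∸ k))
        (descent-from-v1 k≤ℓ' [-]) route-length
        (v1≤rung ∷ AllP.++⁺ (rungs-above-all k (ℓ' ∸ k) rung-below-rung) (NP.≤-refl ∷ []))
        where
        rung-below-rung : ∀ j → k ℕ.< j → j ≤ ℓ' ∸ k + k → L (rung j) ≤ᶠ L (rung k)
        rung-below-rung j k<j j≤ = NP.<⇒≤ (NP.<-≤-trans
          (higher-below j k<j (subst (j ≤_) (NP.m∸n+n≡m k≤ℓ') j≤)) v1≤rung)

    -- Downward induction on k; the fuel d bounds ℓ' − k.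
    rung-below-from : ∀ d k → k ≤ ℓ' → ℓ' ≤ d + k → L (rung k) < L (v1 S h)
    rung-below-from zero    k k≤ℓ' ℓ'≤k = rung-below-step k k≤ℓ' λ j k<j j≤ℓ' →
      ⊥-elim (NP.<-irrefl refl (NP.<-≤-trans k<j (NP.≤-trans j≤ℓ' ℓ'≤k)))
    rung-below-from (suc d) k k≤ℓ' ℓ'≤ = rung-below-step k k≤ℓ' λ j k<j j≤ℓ' →
      rung-below-from d j j≤ℓ' (NP.≤-trans ℓ'≤ (subst (_≤ d + j) (NP.+-suc d k) (NP.+-monoʳ-≤ d k<j)))

    rung-below : ∀ k → k ≤ ℓ' → L (rung k) < L (v1 S h)
    rung-below k k≤ℓ' = rung-below-from ℓ' k k≤ℓ' (NP.m≤m+n ℓ' k)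

    p-below : (i : Fin (suc ℓ')) → L (p S h i) < L (v1 S h)
    p-below i = subst (λ w → L w < L (v1 S h)) (rung-toℕ i) (rung-below (toℕ i) (FP.toℕ≤pred[n] i))

    -- Every vertex of D_x lies below v_S^1: otherwise the whole path followed
    -- by dx j is a low route, with ℓ + 1 ≤ c − 1 edges.
    dx-below : ∀ j → L (dx j) < L (v1 S h)
    dx-below j = NP.≰⇒> low-route
      where
      mid : List V
      mid = rungs-above 0 ℓ' ++ rung 0 ∷ []

      route : Linked (Descent rank) (v1 S h ∷ mid ++ dx j ∷ [])
      route = subst (λ ws → Linked (Descent rank) (v1 S h ∷ ws))
        (sym (++-assoc (rungs-above 0 ℓ') (rung 0 ∷ []) (dx j ∷ [])))
        (descent-from-v1 z≤n (bottom-rung j ∷ [-]))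

      route-length : 2 + length mid ≤ 3 + c'
      route-length rewrite length-++ (rungs-above 0 ℓ') {rung 0 ∷ []}
                         | length-rungs-above 0 ℓ' | NP.+-comm ℓ' 1 = s≤s (s≤s (s≤s ℓ'≤c'))

      low-route : ¬ (L (v1 S h) ≤ᶠ L (dx j))
      low-route v1≤dx = no-low-route (dx-low j) mid route route-length
        (v1≤dx ∷ AllP.++⁺ (AllP.++⁺ (rungs-above-all 0 ℓ' λ i _ i≤ → rung≤dx i (subst (i ≤_) (NP.+-identityʳ ℓ') i≤))
                                     (rung≤dx 0 z≤n ∷ []))
                          (NP.≤-refl ∷ []))
        where
        rung≤dx : ∀ i → i ≤ ℓ' → L (rung i) ≤ᶠ L (dx j)
        rung≤dx i i≤ℓ' = NP.<⇒≤ (NP.<-≤-trans (rung-below i i≤ℓ') v1≤dx)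

mainTheorem7 : (c : ℕ) → 3 ≤ c →
    (n m : ℕ) (F : Fin m → Subset n) → IsSetCoverInstance n m F →
    (x : Fin n) →
    let open Gadget c n m F x in
    (N : ℕ) (L : V → Fin N) → Bijective _≡_ _≡_ L →
    WcolAtMost E L c t →
    (S : Fin m) (h : x ∈ₛ F S) →
    ((i : Fin (t ∸ 3 * fx + 2)) → L (dx i) < L (v1 S h)) ×
    ((i : Fin ℓ) → L (p S h i) < L (v1 S h))
mainTheorem7 (suc (suc (suc c'))) (s≤s (s≤s (s≤s z≤n))) n m F _ x N L (L-injective , _) wcol S h =
  dx-below , p-below
  where open ElementGadget.Order c' n m F x L L-injective wcol S h
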